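{- Let $k\ge 1$ be an integer. If a graph $G$ has maximum degree $\Delta$, then $G^k=G^{\mathcal{P}}$ for some $(k,2k\Delta^k)$-shortcut system $\mathcal{P}$ for $G$.
   Context: All graphs are finite and simple. $G^k$ has vertex set $V(G)$, distinct $v,w$ adjacent iff $\mathrm{dist}_G(v,w)\le k$. A path of length $k$ has $k$ edges. A non-empty set $\mathcal{P}$ of paths of length at least 1 in $G$ is a $(k,d)$-shortcut system if each path has length at most $k$ and each vertex is an internal vertex of at most $d$ paths in $\mathcal{P}$. $G^{\mathcal{P}}$ is obtained from $G$ by adding an edge $vw$ for each path in $\mathcal{P}$ with endpoints $v,w$. -}

module Defs where

open import Data.Nat using (ℕ; zero; suc; _≤_; _⊔_)
open import Data.Fin using (Fin)
open import Data.Fin.Properties using (_≟_)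
open import Data.List using (List; []; _∷_; _++_; [_]; length; filter; allFin; foldr; map)
open import Data.List.Relation.Unary.Linked using (Linked)
open import Data.List.Relation.Unary.Unique.Propositional using (Unique)
open import Data.List.Relation.Unary.Any using (Any)
import Data.List.Relation.Unary.All
open import Data.Product using (Σ; ∃; _×_; _,_)
open import Data.Sum using (_⊎_)
open import Relation.Nullary using (¬_; Dec)
open import Relation.Binary.PropositionalEquality using (_≡_)

record Graph : Set₁ where
  field
    n     : ℕ
    Adj   : Fin n → Fin n → Set
    adj?  : ∀ v w → Dec (Adj v w)
    sym   : ∀ {v w} → Adj v w → Adj w v
    irr   : ∀ {v} → ¬ Adj v v

module _ (G : Graph) where
  open Graph G
  open import Data.List.Membership.DecPropositional (_≟_ {n = n}) using (_∈?_)

  degree : Fin n → ℕ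
  degree v = length (filter (adj? v) (allFin n))

  -- maximum degree (0 for the graph with no vertices)
  maxDegree : ℕ
  maxDegree = foldr _⊔_ 0 (map degree (allFin n))

  data Walk : Fin n → Fin n → ℕ → Set where
    here : ∀ {v} → Walk v v 0
    step : ∀ {u v w ℓ} → Adj u v → Walk v w ℓ → Walk u w (suc ℓ)

  DistLe : Fin n → Fin n → ℕ → Set
  DistLe v w k = ∃ λ ℓ → ℓ ≤ k × Walk v w ℓ

  PowAdj : ℕ → Fin n → Fin n → Set
  PowAdj k v w = ¬ (v ≡ w) × DistLe v w k

  -- a path given by its start, its internal vertices and its end;
  -- its vertex sequence is start ∷ mid ++ [ end ], its length is suc (length mid)
  record Path : Set where
    constructor mkPath
    field
      start : Fin n
      mid   : List (Fin n)
      end   : Fin n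

  vertices : Path → List (Fin n)
  vertices (mkPath s m e) = s ∷ m ++ [ e ]

  pathLength : Path → ℕ
  pathLength (mkPath _ m _) = suc (length m)

  IsPath : Path → Set
  IsPath p = Linked Adj (vertices p) × Unique (vertices p)

  internalCount : List Path → Fin n → ℕ
  internalCount P v = length (filter (λ p → v ∈? Path.mid p) P)

  -- (k,d)-shortcut system (paths of length ≥ 1 is automatic from the representation)
  IsShortcutSystem : ℕ → ℕ → List Path → Set
  IsShortcutSystem k d P =
    ¬ (P ≡ [])
    × Data.List.Relation.Unary.All.All (λ p → IsPath p × pathLength p ≤ k) P
    × (∀ v → internalCount P v ≤ d)

  ShortcutAdj : List Path → Fin n → Fin n → Set
  ShortcutAdj P v w =
    Adj v w ⊎ Any (λ p → (Path.start p ≡ v × Path.end p ≡ w) ⊎ (Path.start p ≡ w × Path.end p ≡ v)) P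

  SameGraph : (Fin n → Fin n → Set) → (Fin n → Fin n → Set) → Set
  SameGraph A B = ∀ v w → (A v w → B v w) × (B v w → A v w)

module Submission where

-- Lemma 3.1: for k ≥ 1 and a graph G of maximum degree Δ ≥ 1, the list P of
-- ALL paths of G of length at most k is a (k, 2kΔ^k)-shortcut system with
-- G^P = G^k.
--
-- G^P = G^k: a path of length ≤ k is a walk of length ≤ k; conversely a walk
-- of length ≤ k between distinct vertices loop-erases to a path of length ≤ k.
--
-- The degree bound: fix a vertex u.  Cutting a path of length ≤ k = K + 2 at
-- its internal vertex u yields a walk of length a+1 into u and a walk of
-- length b+1 out of u with a + b ≤ K, and this encoding is injective.  Under
-- bounded branching there are at most Δ^j walks of length j into or out of u,
-- so for Δ ≥ 2 a geometric sum bounds the count by (K+1)·2Δ^k ≤ 2kΔ^k.  If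
-- k ≤ 1 or Δ ≤ 1 no path has an internal vertex at all.

open import Defs
open import Data.Nat
  using (ℕ; zero; suc; _≤_; _<_; _+_; _*_; _∸_; _^_; _⊔_; z≤n; s≤s; s≤s⁻¹; _≤?_)
open import Data.Nat.Properties
open import Data.Fin using (Fin)
open import Data.Fin.Properties using () renaming (_≟_ to _≟F_)
open import Data.List
  using (List; []; _∷_; _++_; [_]; length; filter; allFin; foldr; map; concatMap;
         deduplicate; downFrom; cartesianProduct; initLast; _∷ʳ′_)
open import Data.List.Properties
  using (length-++; length-map; length-downFrom; ≡-dec; ∷-injective; ∷ʳ-injective; ++-assoc)
open import Data.List.Membership.Propositional using (_∈_; _∉_; lose; find)
open import Data.List.Membership.Propositional.Properties
  using (∈-∃++; ∈-++⁺ʳ; ∈-map⁺; ∈-map⁻; ∈-filter⁺; ∈-filter⁻; ∈-allFin; ∈-concatMap⁺;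
         ∈-downFrom⁺; ∈-downFrom⁻; ∈-cartesianProduct⁺; ∈-deduplicate⁺; ∈-deduplicate⁻)
open import Data.List.Relation.Unary.Any using (here; there; any?)
open import Data.List.Relation.Unary.All using ([]; _∷_)
import Data.List.Relation.Unary.All as All
open import Data.List.Relation.Unary.All.Properties.Core using (¬Any⇒All¬)
open import Data.List.Relation.Unary.AllPairs using ([]; _∷_; allPairs?)
open import Data.List.Relation.Unary.Linked using (Linked; []; [-]; _∷_; linked?)
open import Data.List.Relation.Unary.Unique.Propositional using (Unique)
open import Data.List.Relation.Unary.Unique.Propositional.Properties using (filter⁺)
open import Data.List.Relation.Unary.Unique.DecPropositional.Properties using (deduplicate-!)
open import Data.Product using (∃; _×_; _,_; proj₁; proj₂)
open import Data.Product.Properties using (,-injective)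
open import Data.Sum using (inj₁; inj₂)
open import Data.Empty using (⊥-elim)
open import Relation.Nullary using (¬_; yes; no; Dec; ¬?; contradiction)
open import Relation.Nullary.Decidable using (_×-dec_)
open import Relation.Binary.Definitions using (DecidableEquality)
open import Relation.Binary.PropositionalEquality
  using (_≡_; _≢_; refl; sym; trans; cong; cong₂; subst; module ≡-Reasoning)

-- Counting facts for lists

module ListCounting where

  private variable
    A B : Set

  ∈-delete : ∀ {z x : A} (us vs : List A) → z ∈ us ++ x ∷ vs → z ≢ x → z ∈ us ++ vs
  ∈-delete []       vs (here z≡x) z≢x = ⊥-elim (z≢x z≡x)
  ∈-delete []       vs (there z∈) z≢x = z∈
  ∈-delete (u ∷ us) vs (here z≡u) z≢x = here z≡u
  ∈-delete (u ∷ us) vs (there z∈) z≢x = there (∈-delete us vs z∈ z≢x)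

  length-≤-injection : (f : A → B) {xs : List A} {ys : List B} → Unique xs →
    (∀ {x} → x ∈ xs → f x ∈ ys) →
    (∀ {x y} → x ∈ xs → y ∈ xs → f x ≡ f y → x ≡ y) →
    length xs ≤ length ys
  length-≤-injection f {[]}     _          _     _   = z≤n
  length-≤-injection f {x ∷ xs} (x∉ ∷ uxs) maps∈ inj with ∈-∃++ (maps∈ (here refl))
  ... | us , vs , refl = begin
      suc (length xs)           ≤⟨ s≤s rest ⟩
      suc (length (us ++ vs))   ≡⟨ cong suc (length-++ us) ⟩
      suc (length us + length vs) ≡⟨ +-suc (length us) (length vs) ⟨
      length us + length (f x ∷ vs) ≡⟨ length-++ us ⟨
      length (us ++ f x ∷ vs)   ∎
    where
    open ≤-Reasoning
    -- the other elements land in ys with the occurrence of f x removed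
    rest : length xs ≤ length (us ++ vs)
    rest = length-≤-injection f uxs
      (λ z∈ → ∈-delete us vs (maps∈ (there z∈))
                 (λ fz≡fx → All.lookup x∉ z∈ (sym (inj (there z∈) (here refl) fz≡fx))))
      (λ x∈ y∈ → inj (there x∈) (there y∈))

  length-≤-if-empty : (xs : List A) (c : ℕ) → (∀ {x} → x ∉ xs) → length xs ≤ c
  length-≤-if-empty []       c _     = z≤n
  length-≤-if-empty (x ∷ xs) c empty = ⊥-elim (empty (here refl))

  length-concatMap-≤ : (f : A → List B) (xs : List A) (c : ℕ) →
    (∀ {x} → x ∈ xs → length (f x) ≤ c) → length (concatMap f xs) ≤ length xs * c
  length-concatMap-≤ f []       c bound = z≤n
  length-concatMap-≤ f (x ∷ xs) c bound = begin
      length (f x ++ concatMap f xs)         ≡⟨ length-++ (f x) ⟩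
      length (f x) + length (concatMap f xs) ≤⟨ +-mono-≤ (bound (here refl))
                                                  (length-concatMap-≤ f xs c (λ x∈ → bound (there x∈))) ⟩
      c + length xs * c                      ∎
    where open ≤-Reasoning

  length-cartesianProduct : (xs : List A) (ys : List B) →
    length (cartesianProduct xs ys) ≡ length xs * length ys
  length-cartesianProduct []       ys = refl
  length-cartesianProduct (x ∷ xs) ys = begin
      length (map (x ,_) ys ++ cartesianProduct xs ys)          ≡⟨ length-++ (map (x ,_) ys) ⟩
      length (map (x ,_) ys) + length (cartesianProduct xs ys) ≡⟨ cong₂ _+_ (length-map (x ,_) ys)
                                                                   (length-cartesianProduct xs ys) ⟩
      length ys + length xs * length ys                        ∎
    where open ≡-Reasoning

  listsOfLength : List A → ℕ → List (List A)
  listsOfLength as zero    = [ [] ]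
  listsOfLength as (suc j) = concatMap (λ x → map (x ∷_) (listsOfLength as j)) as

  ∈-listsOfLength : {as : List A} → (∀ x → x ∈ as) → ∀ xs → xs ∈ listsOfLength as (length xs)
  ∈-listsOfLength every []       = here refl
  ∈-listsOfLength every (x ∷ xs) =
    ∈-concatMap⁺ _ (lose (every x) (∈-map⁺ (x ∷_) (∈-listsOfLength every xs)))

  splitAtFirst : DecidableEquality A → A → List A → List A × List A
  splitAtFirst _≟_ u []       = [] , []
  splitAtFirst _≟_ u (x ∷ xs) with x ≟ u
  ... | yes _ = [] , xs
  ... | no  _ = x ∷ proj₁ (splitAtFirst _≟_ u xs) , proj₂ (splitAtFirst _≟_ u xs)

  splitAtFirst-spec : (_≟_ : DecidableEquality A) (u : A) {xs : List A} → u ∈ xs →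
    xs ≡ proj₁ (splitAtFirst _≟_ u xs) ++ u ∷ proj₂ (splitAtFirst _≟_ u xs)
  splitAtFirst-spec _≟_ u {x ∷ xs} u∈ with x ≟ u
  splitAtFirst-spec _≟_ u {x ∷ xs} u∈          | yes refl = refl
  splitAtFirst-spec _≟_ u {x ∷ xs} (here u≡x)  | no  x≢u = ⊥-elim (x≢u (sym u≡x))
  splitAtFirst-spec _≟_ u {x ∷ xs} (there u∈)  | no  x≢u = cong (x ∷_) (splitAtFirst-spec _≟_ u u∈)

open ListCounting

length-snoc : ∀ {A : Set} (xs : List A) (y : A) → length (xs ++ [ y ]) ≡ suc (length xs)
length-snoc xs y = trans (length-++ xs) (+-comm (length xs) 1)

≤-foldr-⊔ : ∀ (xs : List ℕ) {x} → x ∈ xs → x ≤ foldr _⊔_ 0 xs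
≤-foldr-⊔ (y ∷ xs) (here refl) = m≤m⊔n y _
≤-foldr-⊔ (y ∷ xs) (there x∈)  = ≤-trans (≤-foldr-⊔ xs x∈) (m≤n⊔m y _)

foldr-⊔-positive : ∀ (xs : List ℕ) → 1 ≤ foldr _⊔_ 0 xs → ∃ λ x → x ∈ xs × 1 ≤ x
foldr-⊔-positive (zero  ∷ xs) pos with foldr-⊔-positive xs pos
... | x , x∈ , 1≤x = x , there x∈ , 1≤x
foldr-⊔-positive (suc y ∷ xs) pos = suc y , here refl , s≤s z≤n

length-concatMap-geometric : {B : Set} (Δ c : ℕ) → 2 ≤ Δ → (f : ℕ → List B) →
  (∀ b → length (f b) ≤ c * Δ ^ suc b) → ∀ m → length (concatMap f (downFrom m)) ≤ 2 * c * Δ ^ m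
length-concatMap-geometric Δ c 2≤Δ f bound zero    = z≤n
length-concatMap-geometric Δ c 2≤Δ f bound (suc m) = begin
    length (f m ++ concatMap f (downFrom m))         ≡⟨ length-++ (f m) ⟩
    length (f m) + length (concatMap f (downFrom m)) ≤⟨ +-mono-≤ (bound m)
                                                          (length-concatMap-geometric Δ c 2≤Δ f bound m) ⟩
    c * Δ ^ suc m + 2 * c * Δ ^ m                    ≤⟨ +-monoʳ-≤ (c * Δ ^ suc m) previous≤last ⟩
    c * Δ ^ suc m + c * Δ ^ suc m                    ≡⟨ cong (c * Δ ^ suc m +_) (+-identityʳ _) ⟨
    2 * (c * Δ ^ suc m)                              ≡⟨ *-assoc 2 c (Δ ^ suc m) ⟨
    2 * c * Δ ^ suc m                                ∎
  where
  open ≤-Reasoning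
  -- the tail of the sum is at most its largest term, since Δ ≥ 2
  previous≤last : 2 * c * Δ ^ m ≤ c * Δ ^ suc m
  previous≤last = begin
    2 * c * Δ ^ m   ≡⟨ cong (_* Δ ^ m) (*-comm 2 c) ⟩
    c * 2 * Δ ^ m   ≡⟨ *-assoc c 2 (Δ ^ m) ⟩
    c * (2 * Δ ^ m) ≤⟨ *-monoʳ-≤ c (*-monoˡ-≤ (Δ ^ m) 2≤Δ) ⟩
    c * Δ ^ suc m   ∎

-- Chains: lists of vertices in which consecutive entries are R-related

module Chains {A : Set} (R : A → A → Set) where

  lastOf : A → List A → A
  lastOf v []       = v
  lastOf v (x ∷ xs) = lastOf x xs

  lastOf-++ : ∀ v pre w ys → lastOf v (pre ++ w ∷ ys) ≡ lastOf w ys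
  lastOf-++ v []        w ys = refl
  lastOf-++ v (x ∷ pre) w ys = lastOf-++ x pre w ys

  linked-split : ∀ xs {y ys} → Linked R (xs ++ y ∷ ys) → Linked R (xs ++ [ y ]) × Linked R (y ∷ ys)
  linked-split []            L       = [-] , L
  linked-split (x ∷ [])      (r ∷ L) = r ∷ [-] , L
  linked-split (x ∷ x′ ∷ xs) (r ∷ L) with linked-split (x′ ∷ xs) L
  ... | before , after = r ∷ before , after

  unique-suffix : ∀ (pre : List A) {ys} → Unique (pre ++ ys) → Unique ys
  unique-suffix []        U       = U
  unique-suffix (x ∷ pre) (_ ∷ U) = unique-suffix pre U

  SimpleChain : A → List A → ℕ → Set
  SimpleChain v ys ℓ = Linked R (v ∷ ys) × Unique (v ∷ ys) × length ys ≤ ℓ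

  cut-at : ∀ v zs → v ∈ zs → Linked R zs → Unique zs →
    ∃ λ suf → SimpleChain v suf (length zs ∸ 1) × lastOf v suf ≡ lastOf v zs
  cut-at v zs v∈ L U with ∈-∃++ v∈
  ... | pre , suf , refl =
    suf , (proj₂ (linked-split pre L) , unique-suffix pre U , shorter) , sym (lastOf-++ v pre v suf)
    where
    shorter : length suf ≤ length (pre ++ v ∷ suf) ∸ 1
    shorter = begin
      length suf                          ≤⟨ m≤n+m (length suf) (length pre) ⟩
      length pre + length suf             ≡⟨ cong (_∸ 1) (+-suc (length pre) (length suf)) ⟨
      length pre + suc (length suf) ∸ 1   ≡⟨ cong (_∸ 1) (length-++ pre) ⟨
      length (pre ++ v ∷ suf) ∸ 1         ∎
      where open ≤-Reasoning

  loop-erase : DecidableEquality A → ∀ v xs → Linked R (v ∷ xs) →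
    ∃ λ ys → SimpleChain v ys (length xs) × lastOf v ys ≡ lastOf v xs
  loop-erase _≟_ v []       _ = [] , ([-] , [] ∷ [] , z≤n) , refl
  loop-erase _≟_ v (x ∷ xs) (r ∷ L) with loop-erase _≟_ x xs L
  ... | ys , (L′ , U′ , len≤) , last≡ with any? (v ≟_) (x ∷ ys)
  ... | no  v∉ = x ∷ ys , (r ∷ L′ , ¬Any⇒All¬ _ v∉ ∷ U′ , s≤s len≤) , last≡
  ... | yes v∈ with cut-at v (x ∷ ys) v∈ L′ U′
  ...   | suf , (L″ , U″ , len≤′) , last≡′ =
    suf , (L″ , U″ , ≤-trans len≤′ (m≤n⇒m≤1+n len≤)) , trans last≡′ last≡

-- Enumerating walks when every vertex has at most D listed neighbours

module BoundedBranching
  {A : Set} (R : A → A → Set) (R-sym : ∀ {x y} → R x y → R y x)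
  (next : A → List A) (next-complete : ∀ {x y} → R x y → y ∈ next x)
  (D : ℕ) (next-bounded : ∀ x → length (next x) ≤ D) where

  walksFrom : ℕ → A → List (List A)
  walksFrom zero    u = [ [] ]
  walksFrom (suc b) u = concatMap (λ w → map (w ∷_) (walksFrom b w)) (next u)

  length-walksFrom : ∀ b u → length (walksFrom b u) ≤ D ^ b
  length-walksFrom zero    u = ≤-refl
  length-walksFrom (suc b) u = begin
      length (walksFrom (suc b) u)
    ≤⟨ length-concatMap-≤ _ (next u) (D ^ b)
         (λ {w} _ → ≤-trans (≤-reflexive (length-map (w ∷_) (walksFrom b w))) (length-walksFrom b w)) ⟩
      length (next u) * D ^ b
    ≤⟨ *-monoˡ-≤ (D ^ b) (next-bounded u) ⟩
      D ^ suc b ∎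
    where open ≤-Reasoning

  ∈-walksFrom : ∀ u xs → Linked R (u ∷ xs) → xs ∈ walksFrom (length xs) u
  ∈-walksFrom u []       _       = here refl
  ∈-walksFrom u (x ∷ xs) (r ∷ L) =
    ∈-concatMap⁺ _ (lose (next-complete r) (∈-map⁺ (x ∷_) (∈-walksFrom x xs L)))

  headOr : A → List A → A
  headOr u []      = u
  headOr u (x ∷ _) = x

  walksInto : ℕ → A → List (List A)
  walksInto zero    u = [ [] ]
  walksInto (suc a) u = concatMap (λ xs → map (_∷ xs) (next (headOr u xs))) (walksInto a u)

  length-walksInto : ∀ a u → length (walksInto a u) ≤ D ^ a
  length-walksInto zero    u = ≤-refl
  length-walksInto (suc a) u = begin
      length (walksInto (suc a) u)
    ≤⟨ length-concatMap-≤ _ (walksInto a u) D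
         (λ {xs} _ → ≤-trans (≤-reflexive (length-map (_∷ xs) (next (headOr u xs))))
                             (next-bounded (headOr u xs))) ⟩
      length (walksInto a u) * D
    ≤⟨ *-monoˡ-≤ D (length-walksInto a u) ⟩
      D ^ a * D
    ≡⟨ *-comm (D ^ a) D ⟩
      D ^ suc a ∎
    where open ≤-Reasoning

  -- prepending a neighbour of the current first vertex (uses symmetry of R)
  ∈-walksInto-∷ : ∀ u {x} xs → R x (headOr u xs) → xs ∈ walksInto (length xs) u →
    (x ∷ xs) ∈ walksInto (suc (length xs)) u
  ∈-walksInto-∷ u {x} xs r xs∈ = ∈-concatMap⁺ _ (lose xs∈ (∈-map⁺ (_∷ xs) (next-complete (R-sym r))))

  ∈-walksInto : ∀ u xs → Linked R (xs ++ [ u ]) → xs ∈ walksInto (length xs) u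
  ∈-walksInto u []           _       = here refl
  ∈-walksInto u (x ∷ [])     (r ∷ L) = ∈-walksInto-∷ u [] r (∈-walksInto u [] L)
  ∈-walksInto u (x ∷ y ∷ ys) (r ∷ L) = ∈-walksInto-∷ u (y ∷ ys) r (∈-walksInto u (y ∷ ys) L)

-- The graph-specific argument

module PowerGraph (G : Graph) where
  open Graph G renaming (sym to Adj-sym)
  open import Data.List.Membership.DecPropositional (_≟F_ {n = n}) using (_∈?_)
  open Chains Adj

  Δ : ℕ
  Δ = maxDegree G

  neighbours : Fin n → List (Fin n)
  neighbours v = filter (adj? v) (allFin n)

  neighbours-bounded : ∀ v → length (neighbours v) ≤ Δ
  neighbours-bounded v = ≤-foldr-⊔ (map (degree G) (allFin n)) (∈-map⁺ (degree G) (∈-allFin v))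

  ∈-neighbours : ∀ {v w} → Adj v w → w ∈ neighbours v
  ∈-neighbours {v} {w} r = ∈-filter⁺ (adj? v) (∈-allFin w) r

  open BoundedBranching Adj Adj-sym neighbours ∈-neighbours Δ neighbours-bounded

  two-neighbours⇒2≤Δ : ∀ {x a b} → Adj x a → Adj x b → a ≢ b → 2 ≤ Δ
  two-neighbours⇒2≤Δ {x} {a} {b} ra rb a≢b =
    ≤-trans (length-≤-injection (λ z → z) ((a≢b ∷ []) ∷ [] ∷ []) listed (λ _ _ eq → eq))
            (neighbours-bounded x)
    where
    listed : ∀ {z} → z ∈ a ∷ b ∷ [] → z ∈ neighbours x
    listed (here refl)         = ∈-neighbours ra
    listed (there (here refl)) = ∈-neighbours rb

  -- The first internal vertex of a path sees its two distinct path-neighbours.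
  internal-vertex⇒2≤Δ : ∀ {s x m e} → IsPath G (mkPath s (x ∷ m) e) → 2 ≤ Δ
  internal-vertex⇒2≤Δ {m = []}    (r₁ ∷ r₂ ∷ _ , (_ ∷ s≢e ∷ _) ∷ _) =
    two-neighbours⇒2≤Δ (Adj-sym r₁) r₂ s≢e
  internal-vertex⇒2≤Δ {m = _ ∷ _} (r₁ ∷ r₂ ∷ _ , (_ ∷ s≢y ∷ _) ∷ _) =
    two-neighbours⇒2≤Δ (Adj-sym r₁) r₂ s≢y

  edge-exists : 1 ≤ Δ → ∃ λ v → ∃ (Adj v)
  edge-exists pos with foldr-⊔-positive (map (degree G) (allFin n)) pos
  ... | d , d∈ , 1≤d with ∈-map⁻ (degree G) d∈
  ... | v , _ , refl with neighbours v in eq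
  ...   | []    = ⊥-elim (n≮0 1≤d)
  ...   | w ∷ _ = v , w , proj₂ (∈-filter⁻ (adj? v) {xs = allFin n} (subst (w ∈_) (sym eq) (here refl)))

  walk→chain : ∀ {v w ℓ} → Walk G v w ℓ → ∃ λ xs → Linked Adj (v ∷ xs) × lastOf v xs ≡ w × length xs ≡ ℓ
  walk→chain here       = [] , [-] , refl , refl
  walk→chain (step r W) with walk→chain W
  ... | xs , L , refl , refl = _ ∷ xs , r ∷ L , refl , refl

  chain→walk : ∀ v xs → Linked Adj (v ∷ xs) → Walk G v (lastOf v xs) (length xs)
  chain→walk v []       _       = here
  chain→walk v (x ∷ xs) (r ∷ L) = step r (chain→walk x xs L)

  reverse-onto : ∀ {u w x a b} → Walk G u w a → Walk G u x b → Walk G w x (a + b)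
  reverse-onto here                       acc = acc
  reverse-onto {a = suc a} {b} (step r W) acc = subst (Walk G _ _) (+-suc a b) (reverse-onto W (step (Adj-sym r) acc))

  PowAdj-sym : ∀ k {v w} → PowAdj G k v w → PowAdj G k w v
  PowAdj-sym k (v≢w , ℓ , ℓ≤k , W) =
    (λ w≡v → v≢w (sym w≡v)) , ℓ + 0 , subst (_≤ k) (sym (+-identityʳ ℓ)) ℓ≤k , reverse-onto W here

  chain→path : ∀ v xs → v ≢ lastOf v xs → Linked Adj (v ∷ xs) → Unique (v ∷ xs) →
    ∃ λ p → Path.start p ≡ v × Path.end p ≡ lastOf v xs × IsPath G p × pathLength G p ≡ length xs
  chain→path v xs v≢w L U with initLast xs
  ... | []         = ⊥-elim (v≢w refl)
  ... | mid ∷ʳ′ e = mkPath v mid e , refl , sym (lastOf-++ v mid e []) , (L , U) , sym (length-snoc mid e)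

  path-end-distinct : ∀ {s m e} → IsPath G (mkPath s m e) → s ≢ e
  path-end-distinct {m = m} (_ , s≢rest ∷ _) = All.lookup s≢rest (∈-++⁺ʳ m (here refl))

  path⇒PowAdj : ∀ k {p} → IsPath G p → pathLength G p ≤ k → PowAdj G k (Path.start p) (Path.end p)
  path⇒PowAdj k {mkPath s m e} isPath@(L , _) len≤ =
    path-end-distinct isPath , length (m ++ [ e ]) , subst (_≤ k) (sym (length-snoc m e)) len≤ ,
    subst (λ w → Walk G s w _) (lastOf-++ s m e []) (chain→walk s (m ++ [ e ]) L)

  PowAdj⇒path : ∀ k {v w} → PowAdj G k v w →
    ∃ λ p → Path.start p ≡ v × Path.end p ≡ w × IsPath G p × pathLength G p ≤ k
  PowAdj⇒path k {v} (v≢w , ℓ , ℓ≤k , W) with walk→chain W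
  ... | xs , L , refl , refl with loop-erase _≟F_ v xs L
  ...   | ys , (L′ , U′ , len≤) , last≡ with chain→path v ys (subst (v ≢_) (sym last≡) v≢w) L′ U′
  ...     | p , start≡ , end≡ , isPath , len≡ =
    p , start≡ , trans end≡ last≡ , isPath , ≤-trans (≤-reflexive len≡) (≤-trans len≤ ℓ≤k)

  _≟P_ : DecidableEquality (Path G)
  mkPath s m e ≟P mkPath s′ m′ e′ with s ≟F s′ | ≡-dec _≟F_ m m′ | e ≟F e′
  ... | yes refl | yes refl | yes refl = yes refl
  ... | no  s≢   | _        | _        = no λ { refl → s≢ refl }
  ... | yes _    | no  m≢   | _        = no λ { refl → m≢ refl }
  ... | yes _    | yes _    | no  e≢   = no λ { refl → e≢ refl }

  ShortPath : ℕ → Path G → Set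
  ShortPath k p = IsPath G p × pathLength G p ≤ k

  shortPath? : ∀ k p → Dec (ShortPath k p)
  shortPath? k p =
    (linked? adj? (vertices G p) ×-dec allPairs? (λ x y → ¬? (x ≟F y)) (vertices G p))
      ×-dec (pathLength G p ≤? k)

  candidates : ℕ → List (Path G)
  candidates k = concatMap (λ s → concatMap (λ e →
    concatMap (λ j → map (λ m → mkPath s m e) (listsOfLength (allFin n) j)) (downFrom k))
    (allFin n)) (allFin n)

  ∈-candidates : ∀ k s m e → length m < k → mkPath s m e ∈ candidates k
  ∈-candidates k s m e m<k =
    ∈-concatMap⁺ _ (lose (∈-allFin s) (∈-concatMap⁺ _ (lose (∈-allFin e)
      (∈-concatMap⁺ _ (lose (∈-downFrom⁺ m<k)
        (∈-map⁺ (λ m → mkPath s m e) (∈-listsOfLength ∈-allFin m)))))))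

  shortPaths : ℕ → List (Path G)
  shortPaths k = deduplicate _≟P_ (filter (shortPath? k) (candidates k))

  shortPaths-sound : ∀ k {p} → p ∈ shortPaths k → ShortPath k p
  shortPaths-sound k p∈ =
    proj₂ (∈-filter⁻ (shortPath? k) {xs = candidates k} (∈-deduplicate⁻ _≟P_ (filter (shortPath? k) (candidates k)) p∈))

  shortPaths-complete : ∀ k p → ShortPath k p → p ∈ shortPaths k
  shortPaths-complete k (mkPath s m e) short@(_ , s≤s len≤) =
    ∈-deduplicate⁺ _≟P_ {xs = filter (shortPath? k) (candidates k)}
      (∈-filter⁺ (shortPath? k) {xs = candidates k} (∈-candidates k s m e (s≤s len≤)) short)

  through : ℕ → Fin n → List (Path G)
  through k u = filter (λ p → u ∈? Path.mid p) (shortPaths k)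

  through-sound : ∀ k u {p} → p ∈ through k u → u ∈ Path.mid p × ShortPath k p
  through-sound k u p∈ with ∈-filter⁻ (λ p → u ∈? Path.mid p) {xs = shortPaths k} p∈
  ... | p∈′ , u∈ = u∈ , shortPaths-sound k p∈′

  through-unique : ∀ k u → Unique (through k u)
  through-unique k u = filter⁺ (λ p → u ∈? Path.mid p) (deduplicate-! _≟P_ (filter (shortPath? k) (candidates k)))

  through⇒2≤k×2≤Δ : ∀ k u {p} → p ∈ through k u → 2 ≤ k × 2 ≤ Δ
  through⇒2≤k×2≤Δ k u {p} p∈ with through-sound k u p∈
  through⇒2≤k×2≤Δ k u {mkPath s [] e}      p∈ | () , _
  through⇒2≤k×2≤Δ k u {mkPath s (x ∷ m) e} p∈ | _ , isPath , len≤ =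
    ≤-trans (s≤s (s≤s z≤n)) len≤ , internal-vertex⇒2≤Δ isPath

  cutAt : Fin n → Path G → List (Fin n) × List (Fin n)
  cutAt u (mkPath s m e) = s ∷ proj₁ (splitAtFirst _≟F_ u m) , proj₂ (splitAtFirst _≟F_ u m) ++ [ e ]

  cutAt-injective : ∀ u {p q} → u ∈ Path.mid p → u ∈ Path.mid q → cutAt u p ≡ cutAt u q → p ≡ q
  cutAt-injective u {mkPath s m e} {mkPath s′ m′ e′} u∈m u∈m′ eq with ,-injective eq
  ... | before≡ , after≡ with ∷-injective before≡ | ∷ʳ-injective _ _ after≡
  ...   | refl , mid-before≡ | mid-after≡ , refl = cong (λ mid → mkPath s mid e) (begin
      m                                                         ≡⟨ splitAtFirst-spec _≟F_ u u∈m ⟩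
      proj₁ (splitAtFirst _≟F_ u m) ++ u ∷ proj₂ (splitAtFirst _≟F_ u m)
        ≡⟨ cong₂ (λ xs ys → xs ++ u ∷ ys) mid-before≡ mid-after≡ ⟩
      proj₁ (splitAtFirst _≟F_ u m′) ++ u ∷ proj₂ (splitAtFirst _≟F_ u m′) ≡⟨ splitAtFirst-spec _≟F_ u u∈m′ ⟨
      m′                                                        ∎)
    where open ≡-Reasoning

  codePairs : Fin n → ℕ → ℕ → List (List (Fin n) × List (Fin n))
  codePairs u a b = cartesianProduct (walksInto (suc a) u) (walksFrom (suc b) u)

  -- the possible codes of the paths of length ≤ K + 2 through u: a + b ≤ K
  codes : Fin n → ℕ → List (List (Fin n) × List (Fin n))
  codes u K = concatMap (λ a → concatMap (codePairs u a) (downFrom (suc (K ∸ a)))) (downFrom (suc K))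

  cutAt-∈-codes : ∀ K u {p} → p ∈ through (2 + K) u → cutAt u p ∈ codes u K
  cutAt-∈-codes K u {mkPath s m e} p∈ with through-sound (2 + K) u p∈
  ... | u∈m , (L , _) , len≤ =
    ∈-concatMap⁺ _ (lose (∈-downFrom⁺ a<) (∈-concatMap⁺ _ (lose (∈-downFrom⁺ b<)
      (∈-cartesianProduct⁺ before∈ after∈))))
    where
    before = proj₁ (splitAtFirst _≟F_ u m)
    after  = proj₂ (splitAtFirst _≟F_ u m)
    a = length before
    b = length after
    m≡ : m ≡ before ++ u ∷ after
    m≡ = splitAtFirst-spec _≟F_ u u∈m
    regroup : s ∷ m ++ [ e ] ≡ (s ∷ before) ++ u ∷ (after ++ [ e ])
    regroup = trans (cong (λ mid → s ∷ mid ++ [ e ]) m≡) (cong (s ∷_) (++-assoc before (u ∷ after) [ e ]))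
    halves = linked-split (s ∷ before) (subst (Linked Adj) regroup L)
    before∈ : (s ∷ before) ∈ walksInto (suc a) u
    before∈ = ∈-walksInto u (s ∷ before) (proj₁ halves)
    after∈ : (after ++ [ e ]) ∈ walksFrom (suc b) u
    after∈ = subst (λ j → (after ++ [ e ]) ∈ walksFrom j u) (length-snoc after e)
                   (∈-walksFrom u (after ++ [ e ]) (proj₂ halves))
    a+b≤K : a + b ≤ K
    a+b≤K = s≤s⁻¹ (subst (_≤ suc K) (trans (cong length m≡) (trans (length-++ before) (+-suc a b))) (s≤s⁻¹ len≤))
    a< : a < suc K
    a< = s≤s (m+n≤o⇒m≤o a a+b≤K)
    b< : b < suc (K ∸ a)
    b< = s≤s (m+n≤o⇒m≤o∸n b (subst (_≤ K) (+-comm a b) a+b≤K))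

  -- For Δ ≥ 2 there are at most (K+1)·2Δ^(K+2) ≤ 2(K+2)Δ^(K+2) codes.
  length-codes : 2 ≤ Δ → ∀ u K → length (codes u K) ≤ 2 * (2 + K) * Δ ^ (2 + K)
  length-codes 2≤Δ u K = begin
      length (codes u K)
    ≤⟨ length-concatMap-≤ (λ a → concatMap (codePairs u a) (downFrom (suc (K ∸ a)))) (downFrom (suc K))
         (2 * Δ ^ (2 + K)) (λ a∈ → block (∈-downFrom⁻ a∈)) ⟩
      length (downFrom (suc K)) * (2 * Δ ^ (2 + K))
    ≡⟨ cong (_* (2 * Δ ^ (2 + K))) (length-downFrom (suc K)) ⟩
      suc K * (2 * Δ ^ (2 + K))
    ≡⟨ *-assoc (suc K) 2 (Δ ^ (2 + K)) ⟨
      suc K * 2 * Δ ^ (2 + K)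
    ≡⟨ cong (_* Δ ^ (2 + K)) (*-comm (suc K) 2) ⟩
      2 * suc K * Δ ^ (2 + K)
    ≤⟨ *-monoˡ-≤ (Δ ^ (2 + K)) (*-monoʳ-≤ 2 (n≤1+n (suc K))) ⟩
      2 * (2 + K) * Δ ^ (2 + K) ∎
    where
    open ≤-Reasoning
    pair-bound : ∀ a b → length (codePairs u a b) ≤ Δ ^ suc a * Δ ^ suc b
    pair-bound a b = ≤-trans (≤-reflexive (length-cartesianProduct (walksInto (suc a) u) (walksFrom (suc b) u)))
                             (*-mono-≤ (length-walksInto (suc a) u) (length-walksFrom (suc b) u))
    block : ∀ {a} → a < suc K → length (concatMap (codePairs u a) (downFrom (suc (K ∸ a)))) ≤ 2 * Δ ^ (2 + K)
    block {a} (s≤s a≤K) = begin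
        length (concatMap (codePairs u a) (downFrom (suc (K ∸ a))))
      ≤⟨ length-concatMap-geometric Δ (Δ ^ suc a) 2≤Δ (codePairs u a) (pair-bound a) (suc (K ∸ a)) ⟩
        2 * Δ ^ suc a * Δ ^ suc (K ∸ a)
      ≡⟨ *-assoc 2 (Δ ^ suc a) (Δ ^ suc (K ∸ a)) ⟩
        2 * (Δ ^ suc a * Δ ^ suc (K ∸ a))
      ≡⟨ cong (2 *_) (^-distribˡ-+-* Δ (suc a) (suc (K ∸ a))) ⟨
        2 * Δ ^ (suc a + suc (K ∸ a))
      ≡⟨ cong (λ j → 2 * Δ ^ suc j) (trans (+-suc a (K ∸ a)) (cong suc (m+[n∸m]≡n a≤K))) ⟩
        2 * Δ ^ (2 + K) ∎

  internalCount-bound : ∀ k u → internalCount G (shortPaths k) u ≤ 2 * k * Δ ^ k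
  internalCount-bound zero          u = length-≤-if-empty _ _ λ p∈ → contradiction (proj₁ (through⇒2≤k×2≤Δ 0 u p∈)) λ ()
  internalCount-bound (suc zero)    u = length-≤-if-empty _ _ λ p∈ → contradiction (proj₁ (through⇒2≤k×2≤Δ 1 u p∈)) λ { (s≤s ()) }
  internalCount-bound (suc (suc K)) u with 2 ≤? Δ
  ... | no  2≰Δ = length-≤-if-empty _ _ λ p∈ → 2≰Δ (proj₂ (through⇒2≤k×2≤Δ (2 + K) u p∈))
  ... | yes 2≤Δ = ≤-trans
    (length-≤-injection (cutAt u) (through-unique (2 + K) u) (cutAt-∈-codes K u)
      (λ p∈ q∈ → cutAt-injective u (proj₁ (through-sound _ u p∈)) (proj₁ (through-sound _ u q∈))))
    (length-codes 2≤Δ u K)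

  shortPaths-generate-power : ∀ k → 1 ≤ k → SameGraph G (PowAdj G k) (ShortcutAdj G (shortPaths k))
  shortPaths-generate-power k 1≤k v w = to , from
    where
    to : PowAdj G k v w → ShortcutAdj G (shortPaths k) v w
    to pow with PowAdj⇒path k pow
    ... | p , refl , refl , short = inj₂ (lose (shortPaths-complete k p short) (inj₁ (refl , refl)))
    from : ShortcutAdj G (shortPaths k) v w → PowAdj G k v w
    from (inj₁ r) = (λ { refl → irr r }) , 1 , 1≤k , step r here
    from (inj₂ shortcut) with find shortcut
    ... | p , p∈ , inj₁ (refl , refl) = path⇒PowAdj k (proj₁ (shortPaths-sound k p∈)) (proj₂ (shortPaths-sound k p∈))
    ... | p , p∈ , inj₂ (refl , refl) =
      PowAdj-sym k (path⇒PowAdj k (proj₁ (shortPaths-sound k p∈)) (proj₂ (shortPaths-sound k p∈)))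

  -- An edge of G is a path of length 1, so the shortcut system is non-empty.
  shortPaths-nonempty : ∀ k → 1 ≤ k → 1 ≤ Δ → ¬ shortPaths k ≡ []
  shortPaths-nonempty k 1≤k 1≤Δ P≡[] with edge-exists 1≤Δ
  ... | v , w , r with subst (mkPath v [] w ∈_) P≡[]
                         (shortPaths-complete k (mkPath v [] w) ((r ∷ [-] , (v≢w ∷ []) ∷ [] ∷ []) , 1≤k))
    where
    v≢w : v ≢ w
    v≢w refl = irr r
  ... | ()

lemma31 : (k : ℕ) → 1 ≤ k → (G : Graph) → 1 ≤ maxDegree G →
    ∃ λ P → IsShortcutSystem G k (2 * k * maxDegree G ^ k) P
    × SameGraph G (PowAdj G k) (ShortcutAdj G P)
lemma31 k 1≤k G 1≤Δ =
  shortPaths k ,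
  (shortPaths-nonempty k 1≤k 1≤Δ , All.tabulate (shortPaths-sound k) , internalCount-bound k) ,
  shortPaths-generate-power k 1≤k
  where open PowerGraph G
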